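{- For every connected graph $G$ of order $n$ with diameter two, $\lambda(G)/\psi(G) \geq 3$.
   Context: All graphs are finite, simple and connected. A configuration on $G$ is a function $c: V(G) \to \mathbb{N}\cup\{0\}$ (number of pebbles on each vertex). A pebbling move removes two pebbles from a vertex and places one pebble on an adjacent vertex. A vertex is covered if it has at least one pebble, and dominated if it is covered or adjacent to a covered vertex. The cover pebbling number $\lambda(G)$ is the minimum $m$ such that from every configuration of at least $m$ pebbles there is a sequence of pebbling moves after which every vertex of $G$ is covered. The domination cover pebbling number $\psi(G)$ is the minimum $N$ such that from every configuration of $N$ pebbles there is a sequence of pebbling moves after which every vertex of $G$ is dominated. -}

module Defs where

open import Data.Nat using (ℕ; zero; suc; _+_; _∸_; _≤_; _<_)
open import Data.Fin using (Fin; _≟_)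
open import Data.List using (map)
open import Data.List using (allFin)
open import Data.Nat.ListAction using (sum)
open import Data.Product using (Σ; ∃; ∃-syntax; _×_; _,_)
open import Data.Sum using (_⊎_)
open import Relation.Nullary using (¬_; yes; no)
open import Relation.Binary.PropositionalEquality using (_≡_; _≢_)
open import Relation.Binary.Construct.Closure.ReflexiveTransitive using (Star)

record Graph (n : ℕ) : Set₁ where
  field
    Adj     : Fin n → Fin n → Set
    symmetric : ∀ {u v} → Adj u v → Adj v u
    irrefl    : ∀ {u} → ¬ Adj u u

open Graph public

-- Diameter exactly two: every two distinct vertices are at distance ≤ 2,
-- and some pair of vertices is at distance exactly 2 (distinct, non-adjacent).
-- (This implies connectedness.)
DiameterTwo : ∀ {n} → Graph n → Set
DiameterTwo {n} G =
  (∀ (u v : Fin n) → u ≡ v ⊎ Adj G u v ⊎ ∃[ w ] (Adj G u w × Adj G w v))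
  × ∃[ u ] ∃[ v ] (u ≢ v × ¬ Adj G u v)

Config : ℕ → Set
Config n = Fin n → ℕ

size : ∀ {n} → Config n → ℕ
size {n} c = sum (map c (allFin n))

move : ∀ {n} → Config n → Fin n → Fin n → Config n
move c u v w with w ≟ u
... | yes _ = c u ∸ 2
... | no _ with w ≟ v
...   | yes _ = suc (c v)
...   | no _ = c w

data Step {n} (G : Graph n) : Config n → Config n → Set where
  pebble : ∀ {c u v} → Adj G u v → 2 ≤ c u → Step G c (move c u v)

Reach : ∀ {n} → Graph n → Config n → Config n → Set
Reach G = Star (Step G)

Covered : ∀ {n} → Config n → Fin n → Set
Covered c v = 1 ≤ c v

AllCovered : ∀ {n} → Config n → Set
AllCovered {n} c = ∀ (v : Fin n) → Covered c v

AllDominated : ∀ {n} → Graph n → Config n → Set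
AllDominated {n} G c = ∀ (v : Fin n) → Covered c v ⊎ ∃[ w ] (Adj G v w × Covered c w)

CoverSolvable : ∀ {n} → Graph n → ℕ → Set
CoverSolvable {n} G m = ∀ (c : Config n) → m ≤ size c → ∃[ d ] (Reach G c d × AllCovered d)

DomSolvable : ∀ {n} → Graph n → ℕ → Set
DomSolvable {n} G N = ∀ (c : Config n) → size c ≡ N → ∃[ d ] (Reach G c d × AllDominated G d)

IsMin : (ℕ → Set) → ℕ → Set
IsMin P m = P m × (∀ k → k < m → ¬ P k)

IsCoverPebblingNumber : ∀ {n} → Graph n → ℕ → Set
IsCoverPebblingNumber G = IsMin (CoverSolvable G)

IsDomCoverPebblingNumber : ∀ {n} → Graph n → ℕ → Set
IsDomCoverPebblingNumber G = IsMin (DomSolvable G)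

-- Let x be a vertex of minimum degree δ.  Weigh a pebble 1, 2 or 4 according as it lies on x,
-- next to x, or further away.  A move halves the pebbles and travels one edge, across which the
-- weight at most doubles, so the total weight never increases; a covering configuration weighs at
-- least 1 + 2δ + 4(n − 1 − δ), and starting with every pebble on x gives λ(G) ≥ 4n − 2δ − 3.
--
-- In diameter two, an undominated vertex u and a vertex z with at least two pebbles have an empty
-- common neighbour w, and the move z → w dominates u.  Repeating such moves shows
-- ψ(G) ≤ 2(n − δ − 1) + 1: each move preserves ∑ ⌈c(v)/2⌉, which is at most the number of covered
-- vertices once every vertex holds at most one pebble, hence at most n − δ − 1 while some vertex is
-- undominated.  Also n − 1 pebbles suffice: first fire stacks of at least three pebbles, each move
-- paying one pebble for one newly dominated vertex, then stacks of exactly two.  The first bound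
-- gives 3ψ(G) ≤ λ(G) when n ≤ 2δ, the second when 2δ < n.
--
-- Adjacency is not decidable in general, but the conclusion is, so we may decide the finitely many
-- adjacencies by double-negation elimination on the goal.

module Submission where

open import Defs
open import Data.Empty using (⊥; ⊥-elim)
open import Data.Fin using (Fin; _≟_) renaming (zero to fzero; suc to fsuc)
open import Data.Fin.Properties using (punchInᵢ≢i; any?; all?; ¬∀⟶∃¬; sequence)
open import Data.List using (tabulate; allFin)
open import Data.List.Extrema.Nat using (argmin; f[argmin]≤f[xs])
open import Data.List.Membership.Propositional.Properties using (∈-allFin)
open import Data.List.Properties using (map-tabulate)
import Data.List.Relation.Unary.All as All
open import Data.Nat using (ℕ; zero; suc; _+_; _*_; _∸_; _≤_; _<_; z≤n; s≤s; ⌈_/2⌉; ⌊_/2⌋)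
open import Data.Nat.Induction using (<-wellFounded)
import Data.Nat.ListAction as List
open import Data.Nat.Properties hiding (_≟_)
open import Data.Nat.Properties using () renaming (_≟_ to _≟ℕ_)
open import Data.Nat.Tactic.RingSolver using (solve-∀)
open import Data.Product using (∃; ∃-syntax; _×_; _,_; proj₁)
open import Data.Sum using (_⊎_; inj₁; inj₂; [_,_])
open import Data.Vec.Functional using (removeAt)
open import Effect.Monad using (RawMonad)
open import Function using (_∘_)
open import Induction.WellFounded using (Acc; acc)
open import Level using (Level)
open import Relation.Binary.Construct.Closure.ReflexiveTransitive using (ε; _◅_; _◅◅_)
open import Relation.Binary.PropositionalEquality
  using (_≡_; _≢_; refl; sym; trans; cong; cong₂; subst; module ≡-Reasoning)
open import Relation.Nullary using (¬_; Dec; yes; no)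
open import Relation.Nullary.Decidable using (_⊎-dec_; _×-dec_; decidable-stable; ¬¬-excluded-middle)
open import Relation.Nullary.Negation using (¬¬-Monad)
open import Relation.Unary using (Pred; Decidable; _⊆_; _∪_; _∩_; ∁)
open import Relation.Unary.Properties using (_∪?_; _∩?_; ∁?)
open import Algebra.Properties.Semiring.Sum +-*-semiring
  using (sum; sum-syntax; ∑-distrib-+; sum-cong-≗; sum-remove; *-distribˡ-sum)

private variable
  n : ℕ
  ℓ ℓ′ : Level
  X : Set ℓ
  Y : Set ℓ′

size≡sum : (c : Config n) → size c ≡ sum c
size≡sum {n} c = trans (cong List.sum (map-tabulate (λ v → v) c)) (go n c)
  where
  go : ∀ n (f : Fin n → ℕ) → List.sum (tabulate f) ≡ sum f
  go zero f = refl
  go (suc n) f = cong (f fzero +_) (go n (f ∘ fsuc))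

sum-mono-≤ : {f g : Fin n → ℕ} → (∀ i → f i ≤ g i) → sum f ≤ sum g
sum-mono-≤ {zero} f≤g = z≤n
sum-mono-≤ {suc n} f≤g = +-mono-≤ (f≤g fzero) (sum-mono-≤ (f≤g ∘ fsuc))

sum-const : ∀ n k → ∑[ i < n ] k ≡ n * k
sum-const zero k = refl
sum-const (suc n) k = cong (k +_) (sum-const n k)

f≤sum : (f : Fin n → ℕ) (i : Fin n) → f i ≤ sum f
f≤sum {suc n} f i = ≤-trans (m≤m+n (f i) _) (≤-reflexive (sym (sum-remove f)))

sum-pos : (f : Fin n → ℕ) → 0 < sum f → ∃[ i ] (0 < f i)
sum-pos {suc n} f pos with f fzero in eq
... | suc _ = fzero , subst (0 <_) (sym eq) (s≤s z≤n)
... | zero with sum-pos (f ∘ fsuc) pos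
...   | i , fi>0 = fsuc i , fi>0

sum-agree-except : {f g : Fin n → ℕ} (u : Fin n) → (∀ w → w ≢ u → f w ≡ g w) →
                   sum f + g u ≡ sum g + f u
sum-agree-except {suc n} {f} {g} u f≈g = begin
  sum f + g u                    ≡⟨ cong (_+ g u) (sum-remove f) ⟩
  f u + sum (removeAt f u) + g u ≡⟨ cong (λ s → f u + s + g u) (sum-cong-≗ (λ j → f≈g _ (punchInᵢ≢i u j))) ⟩
  f u + sum (removeAt g u) + g u ≡⟨ swap (f u) _ (g u) ⟩
  g u + sum (removeAt g u) + f u ≡⟨ cong (_+ f u) (sym (sum-remove g)) ⟩
  sum g + f u                    ∎
  where
  open ≡-Reasoning
  swap : ∀ a s b → a + s + b ≡ b + s + a
  swap = solve-∀

sum-agree-except₂ : {f g : Fin n → ℕ} {u v : Fin n} → u ≢ v →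
                    (∀ w → w ≢ u → w ≢ v → f w ≡ g w) →
                    sum f + g u + g v ≡ sum g + f u + f v
sum-agree-except₂ {f = f} {g} {u} {v} u≢v f≈g = begin
  sum f + g u + g v ≡⟨ cong (λ x → sum f + g u + x) (sym h[v]≡g[v]) ⟩
  sum f + g u + h v ≡⟨ swap (sum f) (g u) (h v) ⟩
  sum f + h v + g u ≡⟨ cong (_+ g u) (sum-agree-except v f≈h) ⟩
  sum h + f v + g u ≡⟨ swap (sum h) (f v) (g u) ⟩
  sum h + g u + f v ≡⟨ cong (_+ f v) (sum-agree-except u h≈g) ⟩
  sum g + h u + f v ≡⟨ cong (λ x → sum g + x + f v) (sym (f≈h u u≢v)) ⟩
  sum g + f u + f v ∎
  where
  open ≡-Reasoning
  swap : ∀ a b c → a + b + c ≡ a + c + b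
  swap = solve-∀
  h : Fin _ → ℕ
  h w with w ≟ v
  ... | yes _ = g w
  ... | no _ = f w
  f≈h : ∀ w → w ≢ v → f w ≡ h w
  f≈h w w≢v with w ≟ v
  ... | yes w≡v = ⊥-elim (w≢v w≡v)
  ... | no _ = refl
  h≈g : ∀ w → w ≢ u → h w ≡ g w
  h≈g w w≢u with w ≟ v
  ... | yes _ = refl
  ... | no w≢v = f≈g w w≢u w≢v
  h[v]≡g[v] : h v ≡ g v
  h[v]≡g[v] with v ≟ v
  ... | yes _ = refl
  ... | no v≢v = ⊥-elim (v≢v refl)

sum-zero : ∀ n → ∑[ _ < n ] 0 ≡ 0
sum-zero n = trans (sum-const n 0) (*-zeroʳ n)

sum-single : (f : Fin n → ℕ) (x : Fin n) → (∀ v → v ≢ x → f v ≡ 0) → sum f ≡ f x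
sum-single {n} f x vanish = begin
  sum f                 ≡⟨ sym (+-identityʳ _) ⟩
  sum f + 0             ≡⟨ sum-agree-except x vanish ⟩
  ∑[ _ < n ] 0 + f x    ≡⟨ cong (_+ f x) (sum-zero n) ⟩
  f x                   ∎
  where open ≡-Reasoning

𝟙 : Dec X → ℕ
𝟙 (yes _) = 1
𝟙 (no _) = 0

𝟙-mono : (X → Y) → (a? : Dec X) (b? : Dec Y) → 𝟙 a? ≤ 𝟙 b?
𝟙-mono X⇒Y (yes a) (yes _) = ≤-refl
𝟙-mono X⇒Y (yes a) (no ¬b) = ⊥-elim (¬b (X⇒Y a))
𝟙-mono X⇒Y (no _)  _       = z≤n

𝟙-cong : (X → Y) → (Y → X) → (a? : Dec X) (b? : Dec Y) → 𝟙 a? ≡ 𝟙 b?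
𝟙-cong X⇒Y Y⇒X a? b? = ≤-antisym (𝟙-mono X⇒Y a? b?) (𝟙-mono Y⇒X b? a?)

𝟙-⊎ : (X → Y → ⊥) → (a? : Dec X) (b? : Dec Y) → 𝟙 (a? ⊎-dec b?) ≡ 𝟙 a? + 𝟙 b?
𝟙-⊎ disjoint (yes a) (yes b) = ⊥-elim (disjoint a b)
𝟙-⊎ disjoint (yes _) (no _)  = refl
𝟙-⊎ disjoint (no _)  (yes _) = refl
𝟙-⊎ disjoint (no _)  (no _)  = refl

𝟙-yes : X → (a? : Dec X) → 𝟙 a? ≡ 1
𝟙-yes a (yes _) = refl
𝟙-yes a (no ¬a) = ⊥-elim (¬a a)

𝟙-no : ¬ X → (a? : Dec X) → 𝟙 a? ≡ 0
𝟙-no ¬a (yes a) = ⊥-elim (¬a a)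
𝟙-no ¬a (no _)  = refl

𝟙≤1 : (a? : Dec X) → 𝟙 a? ≤ 1
𝟙≤1 (yes _) = ≤-refl
𝟙≤1 (no _)  = z≤n

count : {P : Pred (Fin n) ℓ} → Decidable P → ℕ
count P? = sum (λ v → 𝟙 (P? v))

module _ {P : Pred (Fin n) ℓ} {Q : Pred (Fin n) ℓ′} (P? : Decidable P) (Q? : Decidable Q) where

  count-mono : P ⊆ Q → count P? ≤ count Q?
  count-mono P⊆Q = sum-mono-≤ (λ v → 𝟙-mono P⊆Q (P? v) (Q? v))

  count-∪ : (∀ {v} → P v → Q v → ⊥) → count (P? ∪? Q?) ≡ count P? + count Q?
  count-∪ disjoint =
    trans (sum-cong-≗ (λ v → 𝟙-⊎ disjoint (P? v) (Q? v))) (∑-distrib-+ (𝟙 ∘ P?) (𝟙 ∘ Q?))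

module _ {P : Pred (Fin n) ℓ} (P? : Decidable P) where

  count≤n : count P? ≤ n
  count≤n = ≤-trans (sum-mono-≤ (λ v → 𝟙≤1 (P? v)))
                    (≤-reflexive (trans (sum-const n 1) (*-identityʳ n)))

  ∈⇒0<count : ∀ {v} → P v → 0 < count P?
  ∈⇒0<count {v} Pv = ≤-trans (≤-reflexive (sym (𝟙-yes Pv (P? v)))) (f≤sum _ v)

  0<count⇒∃ : 0 < count P? → ∃ P
  0<count⇒∃ pos with sum-pos _ pos
  ... | v , 𝟙>0 with P? v
  ...   | yes Pv = v , Pv

  count-split : ∀ u → count P? ≡ 𝟙 (P? u) + count (P? ∩? ∁? (u ≟_))
  count-split u = begin
    count P?               ≡⟨ sym (+-identityʳ _) ⟩
    count P? + 0           ≡⟨ cong (count P? +_) (sym (𝟙-no (λ (_ , u≢u) → u≢u refl) (P?∖u u))) ⟩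
    count P? + 𝟙 (P?∖u u)  ≡⟨ sym (sum-agree-except u agree) ⟩
    count P?∖u + 𝟙 (P? u)  ≡⟨ +-comm (count P?∖u) _ ⟩
    𝟙 (P? u) + count P?∖u  ∎
    where
    open ≡-Reasoning
    P?∖u : Decidable (P ∩ ∁ (u ≡_))
    P?∖u = P? ∩? ∁? (u ≟_)
    agree : ∀ w → w ≢ u → 𝟙 (P?∖u w) ≡ 𝟙 (P? w)
    agree w w≢u = 𝟙-cong proj₁ (λ Pw → Pw , w≢u ∘ sym) (P?∖u w) (P? w)

  count-remove : ∀ {u} → P u → count P? ≡ suc (count (P? ∩? ∁? (u ≟_)))
  count-remove {u} Pu = trans (count-split u) (cong (_+ count (P? ∩? ∁? (u ≟_))) (𝟙-yes Pu (P? u)))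

  ∉⇒count<n : ∀ {u} → ¬ P u → count P? < n
  ∉⇒count<n {u} ¬Pu = begin-strict
    count P?                    ≤⟨ count-mono P? ≢u? (λ Pv u≡v → ¬Pu (subst P (sym u≡v) Pv)) ⟩
    count ≢u?                   <⟨ m<m+n _ (s≤s z≤n) ⟩
    count ≢u? + 1               ≡⟨ sum-agree-except u (λ w w≢u → 𝟙-yes (w≢u ∘ sym) (≢u? w)) ⟩
    ∑[ _ < n ] 1 + 𝟙 (≢u? u)    ≡⟨ cong₂ _+_ (trans (sum-const n 1) (*-identityʳ n))
                                             (𝟙-no (λ u≢u → u≢u refl) (≢u? u)) ⟩
    n + 0                       ≡⟨ +-identityʳ n ⟩
    n                           ∎
    where
    open ≤-Reasoning
    ≢u? : Decidable (∁ (u ≡_))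
    ≢u? = ∁? (u ≟_)

module _ (c : Config n) {u v : Fin n} where

  move-source : move c u v u ≡ c u ∸ 2
  move-source with u ≟ u
  ... | yes _  = refl
  ... | no u≢u = ⊥-elim (u≢u refl)

  move-target : u ≢ v → move c u v v ≡ suc (c v)
  move-target u≢v with v ≟ u
  ... | yes v≡u = ⊥-elim (u≢v (sym v≡u))
  ... | no _ with v ≟ v
  ...   | yes _  = refl
  ...   | no v≢v = ⊥-elim (v≢v refl)

  move-other : ∀ {w} → w ≢ u → w ≢ v → move c u v w ≡ c w
  move-other {w} w≢u w≢v with w ≟ u
  ... | yes w≡u = ⊥-elim (w≢u w≡u)
  ... | no _ with w ≟ v
  ...   | yes w≡v = ⊥-elim (w≢v w≡v)
  ...   | no _    = refl

  sum-move : u ≢ v → (F : Fin n → ℕ → ℕ) →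
             ∑[ w < n ] F w (move c u v w) + F u (c u) + F v (c v) ≡
             ∑[ w < n ] F w (c w) + F u (c u ∸ 2) + F v (suc (c v))
  sum-move u≢v F = begin
    ∑[ w < n ] F w (move c u v w) + F u (c u) + F v (c v)
      ≡⟨ sum-agree-except₂ u≢v (λ w w≢u w≢v → cong (F w) (move-other w≢u w≢v)) ⟩
    ∑[ w < n ] F w (c w) + F u (move c u v u) + F v (move c u v v)
      ≡⟨ cong₂ (λ x y → ∑[ w < n ] F w (c w) + F u x + F v y) move-source (move-target u≢v) ⟩
    ∑[ w < n ] F w (c w) + F u (c u ∸ 2) + F v (suc (c v)) ∎
    where open ≡-Reasoning

module _ (G : Graph n) where

  adjacent⇒distinct : ∀ {u v} → Adj G u v → u ≢ v
  adjacent⇒distinct uv refl = irrefl G uv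

  step-size : ∀ {c d} → Step G c d → suc (size d) ≡ size c
  step-size {c} (pebble {u = u} {v} uv 2≤cu) = begin
    suc (size d) ≡⟨ cong suc (size≡sum d) ⟩
    suc (sum d)  ≡⟨ +-cancelʳ-≡ (x + suc y) _ _ balance ⟩
    sum c        ≡⟨ sym (size≡sum c) ⟩
    size c       ∎
    where
    open ≡-Reasoning
    d : Config n
    d = move c u v
    x y : ℕ
    x = c u ∸ 2
    y = c v
    rearrange : ∀ s x y → suc s + (x + suc y) ≡ s + (x + 2) + y
    rearrange = solve-∀
    balance : suc (sum d) + (x + suc y) ≡ sum c + (x + suc y)
    balance = begin
      suc (sum d) + (x + suc y) ≡⟨ rearrange (sum d) x y ⟩
      sum d + (x + 2) + y       ≡⟨ cong (λ k → sum d + k + y) (m∸n+n≡m 2≤cu) ⟩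
      sum d + c u + c v         ≡⟨ sum-move c (adjacent⇒distinct uv) (λ _ k → k) ⟩
      sum c + x + suc y         ≡⟨ +-assoc (sum c) x (suc y) ⟩
      sum c + (x + suc y)       ∎

  module _ (I Goal : Config n → Set)
           (progress : ∀ {c} → I c → Goal c ⊎ ∃[ d ] (Step G c d × I d)) where

    descend : ∀ {c} → I c → ∃[ d ] (Reach G c d × Goal d)
    descend {c} = go c (<-wellFounded (size c))
      where
      go : ∀ c → Acc _<_ (size c) → I c → ∃[ d ] (Reach G c d × Goal d)
      go c (acc rec) Ic with progress Ic
      ... | inj₁ goal = c , ε , goal
      ... | inj₂ (d , c→d , Id) with go d (rec (≤-reflexive (step-size c→d))) Id
      ...   | e , d↝e , goal = e , c→d ◅ d↝e , goal

no-stack⇒bounded : ∀ {c : Config n} {k} → ¬ ∃ (λ v → suc k ≤ c v) → ∀ v → c v ≤ k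
no-stack⇒bounded none v = ≤-pred (≰⇒> (λ k<cv → none (v , k<cv)))

-- Weights

pile : Fin n → ℕ → Config n
pile x L v with v ≟ x
... | yes _ = L
... | no _  = 0

module _ (x : Fin n) (L : ℕ) where

  pile-here : pile x L x ≡ L
  pile-here with x ≟ x
  ... | yes _  = refl
  ... | no x≢x = ⊥-elim (x≢x refl)

  pile-elsewhere : ∀ v → v ≢ x → pile x L v ≡ 0
  pile-elsewhere v v≢x with v ≟ x
  ... | yes v≡x = ⊥-elim (v≢x v≡x)
  ... | no _    = refl

  size-pile : size (pile x L) ≡ L
  size-pile = trans (size≡sum (pile x L)) (trans (sum-single _ x pile-elsewhere) pile-here)

weight : (Fin n → ℕ) → Config n → ℕ
weight {n} ω c = ∑[ v < n ] (c v * ω v)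

module _ (G : Graph n) (ω : Fin n → ℕ) (ω-halves : ∀ {u v} → Adj G u v → ω v ≤ 2 * ω u) where

  weight-step : ∀ {c d} → Step G c d → weight ω d ≤ weight ω c
  weight-step {c} (pebble {u = u} {v} uv 2≤cu) = +-cancelʳ-≤ K _ _ (begin
    weight ω d + K                             ≡⟨ rearrangeˡ (weight ω d) x y (ω u) (ω v) ⟩
    weight ω d + (x + 2) * ω u + y * ω v       ≡⟨ cong (λ k → weight ω d + k * ω u + y * ω v) (m∸n+n≡m 2≤cu) ⟩
    weight ω d + c u * ω u + c v * ω v         ≡⟨ sum-move c (adjacent⇒distinct G uv) (λ w k → k * ω w) ⟩
    weight ω c + x * ω u + suc y * ω v         ≡⟨ rearrangeʳ (weight ω c) x y (ω u) (ω v) ⟩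
    weight ω c + (x * ω u + y * ω v) + ω v     ≤⟨ +-monoʳ-≤ _ (ω-halves uv) ⟩
    weight ω c + (x * ω u + y * ω v) + 2 * ω u ≡⟨ +-assoc (weight ω c) _ _ ⟩
    weight ω c + K                             ∎)
    where
    open ≤-Reasoning
    d : Config n
    d = move c u v
    x y K : ℕ
    x = c u ∸ 2
    y = c v
    K = x * ω u + y * ω v + 2 * ω u
    rearrangeˡ : ∀ s x y a b → s + (x * a + y * b + 2 * a) ≡ s + (x + 2) * a + y * b
    rearrangeˡ = solve-∀
    rearrangeʳ : ∀ s x y a b → s + x * a + suc y * b ≡ s + (x * a + y * b) + b
    rearrangeʳ = solve-∀

  weight-antitone : ∀ {c d} → Reach G c d → weight ω d ≤ weight ω c
  weight-antitone ε            = ≤-refl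
  weight-antitone (c→c′ ◅ c′↝d) = ≤-trans (weight-antitone c′↝d) (weight-step c→c′)

covered? : (c : Config n) → Decidable (Covered c)
covered? c v = 1 ≤? c v

coverage : Config n → ℕ
coverage c = count (covered? c)

uncovered⇒empty : ∀ {c : Config n} {v} → ¬ Covered c v → c v ≡ 0
uncovered⇒empty ¬cov = n<1⇒n≡0 (≰⇒> ¬cov)

pairs : Config n → ℕ
pairs {n} c = ∑[ v < n ] ⌈ c v /2⌉

⌈n/2⌉≡1+⌈n∸2/2⌉ : ∀ {k} → 2 ≤ k → ⌈ k /2⌉ ≡ suc ⌈ k ∸ 2 /2⌉
⌈n/2⌉≡1+⌈n∸2/2⌉ (s≤s (s≤s _)) = refl

pairs-move : ∀ {c : Config n} {z w} → z ≢ w → 2 ≤ c z → c w ≡ 0 → pairs (move c z w) ≡ pairs c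
pairs-move {n} {c} {z} {w} z≢w 2≤cz cw≡0 = +-cancelʳ-≡ (suc h) _ _ (begin
  pairs c′ + suc h                   ≡⟨ sym (+-identityʳ _) ⟩
  pairs c′ + suc h + 0               ≡⟨ cong₂ (λ a b → pairs c′ + a + ⌈ b /2⌉)
                                              (sym (⌈n/2⌉≡1+⌈n∸2/2⌉ 2≤cz)) (sym cw≡0) ⟩
  pairs c′ + ⌈ c z /2⌉ + ⌈ c w /2⌉   ≡⟨ sum-move c z≢w (λ _ k → ⌈ k /2⌉) ⟩
  pairs c + h + ⌈ suc (c w) /2⌉      ≡⟨ cong (λ b → pairs c + h + ⌈ suc b /2⌉) cw≡0 ⟩
  pairs c + h + 1                    ≡⟨ +-assoc (pairs c) h 1 ⟩
  pairs c + (h + 1)                  ≡⟨ cong (pairs c +_) (+-comm h 1) ⟩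
  pairs c + suc h                    ∎)
  where
  open ≡-Reasoning
  c′ : Config n
  c′ = move c z w
  h : ℕ
  h = ⌈ c z ∸ 2 /2⌉

size≤2*pairs : (c : Config n) → size c ≤ 2 * pairs c
size≤2*pairs {n} c = begin
  size c                         ≡⟨ size≡sum c ⟩
  sum c                          ≤⟨ sum-mono-≤ (λ v → k≤2*⌈k/2⌉ (c v)) ⟩
  ∑[ v < n ] (2 * ⌈ c v /2⌉)     ≡⟨ sym (*-distribˡ-sum 2 (λ v → ⌈ c v /2⌉)) ⟩
  2 * pairs c                    ∎
  where
  open ≤-Reasoning
  k≤2*⌈k/2⌉ : ∀ k → k ≤ 2 * ⌈ k /2⌉
  k≤2*⌈k/2⌉ k = begin
    k                         ≡⟨ sym (⌊n/2⌋+⌈n/2⌉≡n k) ⟩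
    ⌊ k /2⌋ + ⌈ k /2⌉         ≤⟨ +-monoˡ-≤ _ (⌊n/2⌋≤⌈n/2⌉ k) ⟩
    ⌈ k /2⌉ + ⌈ k /2⌉         ≡⟨ cong (⌈ k /2⌉ +_) (sym (+-identityʳ _)) ⟩
    2 * ⌈ k /2⌉               ∎

pairs≤coverage : (c : Config n) → (∀ v → c v ≤ 1) → pairs c ≤ coverage c
pairs≤coverage c all≤1 = sum-mono-≤ (λ v → pointwise (c v) (all≤1 v))
  where
  pointwise : ∀ k → k ≤ 1 → ⌈ k /2⌉ ≤ 𝟙 (1 ≤? k)
  pointwise zero    _       = z≤n
  pointwise (suc _) (s≤s z≤n) = ≤-refl

double? : (c : Config n) → Decidable (λ v → c v ≡ 2)
double? c v = c v ≟ℕ 2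

doubles : Config n → ℕ
doubles c = count (double? c)

dense-arithmetic : ∀ {L d n} → d < n → 4 * n ≤ L + 2 * d + 3 → n ≤ 2 * d →
                   3 * suc (2 * (n ∸ suc d)) ≤ L
dense-arithmetic {L} {d} d<n lower dense with m≤n⇒∃[o]m+o≡n d<n
... | m , refl rewrite m+n∸m≡n (suc d) m = begin
  3 * suc (2 * m)          ≡⟨ e₁ m ⟩
  4 * m + 2 * suc m + 1    ≤⟨ +-monoˡ-≤ 1 (+-monoʳ-≤ (4 * m) (*-monoʳ-≤ 2 m<d)) ⟩
  4 * m + 2 * d + 1        ≤⟨ +-cancelʳ-≤ (2 * d + 3) _ _
                                (≤-trans (≤-reflexive (e₂ m d)) (≤-trans lower (≤-reflexive (e₃ L d)))) ⟩
  L                        ∎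
  where
  open ≤-Reasoning
  e₀ : ∀ m d → suc m + d ≡ suc d + m
  e₀ = solve-∀
  e₁ : ∀ m → 3 * suc (2 * m) ≡ 4 * m + 2 * suc m + 1
  e₁ = solve-∀
  e₂ : ∀ m d → 4 * m + 2 * d + 1 + (2 * d + 3) ≡ 4 * (suc d + m)
  e₂ = solve-∀
  e₃ : ∀ L d → L + 2 * d + 3 ≡ L + (2 * d + 3)
  e₃ = solve-∀
  e₄ : ∀ d → 2 * d ≡ d + d
  e₄ = solve-∀
  m<d : suc m ≤ d
  m<d = +-cancelʳ-≤ d _ _ (≤-trans (≤-reflexive (e₀ m d)) (≤-trans dense (≤-reflexive (e₄ d))))

sparse-arithmetic : ∀ {L d n} → 4 * n ≤ L + 2 * d + 3 → ¬ (n ≤ 2 * d) → 3 * (n ∸ 1) ≤ L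
sparse-arithmetic {n = zero}              _     sparse = ⊥-elim (sparse z≤n)
sparse-arithmetic {L} {d} {n = suc k} lower sparse = ≤-trans (m≤m+n (3 * k) 1) (+-cancelʳ-≤ (k + 3) _ _ (begin
  3 * k + 1 + (k + 3)      ≡⟨ e₁ k ⟩
  4 * suc k                ≤⟨ lower ⟩
  L + 2 * d + 3            ≤⟨ +-monoˡ-≤ 3 (+-monoʳ-≤ L (≤-pred (≰⇒> sparse))) ⟩
  L + k + 3                ≡⟨ +-assoc L k 3 ⟩
  L + (k + 3)              ∎))
  where
  open ≤-Reasoning
  e₁ : ∀ k → 3 * k + 1 + (k + 3) ≡ 4 * suc k
  e₁ = solve-∀

-- The weight bound for cover pebbling

module _ (G : Graph n) (adj? : ∀ u v → Dec (Adj G u v)) where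

  degree : Fin n → ℕ
  degree u = count (adj? u)

  module _ (x : Fin n) where

    ω : Fin n → ℕ
    ω v with v ≟ x | adj? x v
    ... | yes _ | _     = 1
    ... | no _  | yes _ = 2
    ... | no _  | no _  = 4

    ω-here : ω x ≡ 1
    ω-here with x ≟ x
    ... | yes _  = refl
    ... | no x≢x = ⊥-elim (x≢x refl)

    ω-neighbour : ∀ {v} → Adj G x v → ω v ≡ 2
    ω-neighbour {v} xv with v ≟ x | adj? x v
    ... | yes refl | _     = ⊥-elim (irrefl G xv)
    ... | no _     | yes _ = refl
    ... | no _     | no ¬xv = ⊥-elim (¬xv xv)

    ω≤4 : ∀ v → ω v ≤ 4
    ω≤4 v with v ≟ x | adj? x v
    ... | yes _ | _     = s≤s z≤n
    ... | no _  | yes _ = s≤s (s≤s z≤n)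
    ... | no _  | no _  = ≤-refl

    ω-halves : ∀ {u v} → Adj G u v → ω v ≤ 2 * ω u
    ω-halves {u} {v} uv with u ≟ x | adj? x u
    ... | yes refl | _     = ≤-reflexive (ω-neighbour uv)
    ... | no _     | yes _ = ω≤4 v
    ... | no _     | no _  = ≤-trans (ω≤4 v) (m≤m+n 4 4)

    sum-ω : sum ω + 2 * degree x + 3 ≡ 4 * n
    sum-ω = begin
      sum ω + 2 * degree x + 3
        ≡⟨ cong₂ (λ a b → sum ω + a + b) (*-distribˡ-sum 2 (𝟙 ∘ adj? x)) (sym singleton) ⟩
      sum ω + sum (λ v → 2 * 𝟙 (adj? x v)) + sum atX   ≡⟨ cong (_+ sum atX) (sym (∑-distrib-+ ω _)) ⟩
      sum (λ v → ω v + 2 * 𝟙 (adj? x v)) + sum atX     ≡⟨ sym (∑-distrib-+ _ atX) ⟩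
      sum (λ v → ω v + 2 * 𝟙 (adj? x v) + atX v)       ≡⟨ sum-cong-≗ pointwise ⟩
      ∑[ _ < n ] 4                                     ≡⟨ sum-const n 4 ⟩
      n * 4                                            ≡⟨ *-comm n 4 ⟩
      4 * n                                            ∎
      where
      open ≡-Reasoning
      atX : Fin n → ℕ
      atX v = 3 * 𝟙 (v ≟ x)
      singleton : sum atX ≡ 3
      singleton = trans (sum-single atX x (λ v v≢x → cong (3 *_) (𝟙-no v≢x (v ≟ x))))
                        (cong (3 *_) (𝟙-yes refl (x ≟ x)))
      pointwise : ∀ v → ω v + 2 * 𝟙 (adj? x v) + atX v ≡ 4
      pointwise v with v ≟ x | adj? x v
      ... | yes refl | yes xx = ⊥-elim (irrefl G xx)
      ... | yes _    | no _   = refl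
      ... | no _     | yes _  = refl
      ... | no _     | no _   = refl

    weight-pile : ∀ L → weight ω (pile x L) ≡ L
    weight-pile L = begin
      weight ω (pile x L)     ≡⟨ sum-single _ x (λ v v≢x → cong (_* ω v) (pile-elsewhere x L v v≢x)) ⟩
      pile x L x * ω x        ≡⟨ cong₂ _*_ (pile-here x L) ω-here ⟩
      L * 1                   ≡⟨ *-identityʳ L ⟩
      L                       ∎
      where open ≡-Reasoning

    weight-covered : ∀ {d} → AllCovered d → sum ω ≤ weight ω d
    weight-covered {d} covered =
      sum-mono-≤ (λ v → subst (_≤ d v * ω v) (*-identityˡ (ω v)) (*-monoˡ-≤ (ω v) (covered v)))

    cover-lower-bound : ∀ {L} → CoverSolvable G L → 4 * n ≤ L + 2 * degree x + 3
    cover-lower-bound {L} solvable with solvable (pile x L) (≤-reflexive (sym (size-pile x L)))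
    ... | d , pile↝d , covered = begin
      4 * n                              ≡⟨ sym sum-ω ⟩
      sum ω + 2 * degree x + 3           ≤⟨ +-monoˡ-≤ 3 (+-monoˡ-≤ _ weight-bound) ⟩
      L + 2 * degree x + 3               ∎
      where
      open ≤-Reasoning
      weight-bound : sum ω ≤ L
      weight-bound = begin
        sum ω                 ≤⟨ weight-covered covered ⟩
        weight ω d            ≤⟨ weight-antitone G ω ω-halves pile↝d ⟩
        weight ω (pile x L)   ≡⟨ weight-pile L ⟩
        L                     ∎

  Dominated : Config n → Pred (Fin n) _
  Dominated c v = Covered c v ⊎ ∃[ w ] (Adj G v w × Covered c w)

  dominated? : ∀ c → Decidable (Dominated c)
  dominated? c v = covered? c v ⊎-dec any? (λ w → adj? v w ×-dec covered? c w)

  all-dominated-or-witness : ∀ c → AllDominated G c ⊎ ∃ (∁ (Dominated c))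
  all-dominated-or-witness c with all? (dominated? c)
  ... | yes all = inj₁ all
  ... | no ¬all = inj₂ (¬∀⟶∃¬ n (Dominated c) (dominated? c) ¬all)

  dominated-mono : ∀ {c d : Config n} → (∀ {v} → Covered c v → Covered d v) →
                   ∀ {v} → Dominated c v → Dominated d v
  dominated-mono c⊆d (inj₁ cov)            = inj₁ (c⊆d cov)
  dominated-mono c⊆d (inj₂ (w , vw , cov)) = inj₂ (w , vw , c⊆d cov)

  Dominable : Config n → Set
  Dominable c = ∃[ d ] (Reach G c d × AllDominated G d)

  coverage+degree<n : ∀ {c u} → ¬ Dominated c u → coverage c + degree u < n
  coverage+degree<n {c} {u} ¬dom = begin-strict
    coverage c + degree u
      ≡⟨ sym (count-∪ (covered? c) (adj? u) (λ cov uv → ¬dom (inj₂ (_ , uv , cov)))) ⟩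
    count (covered? c ∪? adj? u)
      <⟨ ∉⇒count<n (covered? c ∪? adj? u) [ ¬dom ∘ inj₁ , irrefl G ] ⟩
    n ∎
    where open ≤-Reasoning

  module _ (within-two : ∀ u v → u ≡ v ⊎ Adj G u v ⊎ ∃[ w ] (Adj G u w × Adj G w v)) where

    empty-common-neighbour : ∀ {c u z} → ¬ Dominated c u → Covered c z →
                             ∃[ w ] (Adj G z w × Adj G w u × c w ≡ 0)
    empty-common-neighbour {c} {u} {z} ¬dom cov with within-two u z
    ... | inj₁ refl                 = ⊥-elim (¬dom (inj₁ cov))
    ... | inj₂ (inj₁ uz)            = ⊥-elim (¬dom (inj₂ (z , uz , cov)))
    ... | inj₂ (inj₂ (w , uw , wz)) =
      w , symmetric G wz , symmetric G uw , uncovered⇒empty {c = c} (λ cov-w → ¬dom (inj₂ (w , uw , cov-w)))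

    -- Domination from 2(n − δ − 1) + 1 pebbles

    module _ {δ m : ℕ} (δ≤degree : ∀ v → δ ≤ degree v) (n≤ : n ≤ suc δ + m) where

      coverage≤m : ∀ {c u} → ¬ Dominated c u → coverage c ≤ m
      coverage≤m {c} {u} ¬dom = +-cancelʳ-≤ δ _ _ (≤-pred (begin
        suc (coverage c + δ)        ≤⟨ s≤s (+-monoʳ-≤ _ (δ≤degree u)) ⟩
        suc (coverage c + degree u) ≤⟨ coverage+degree<n ¬dom ⟩
        n                           ≤⟨ n≤ ⟩
        suc (δ + m)                 ≡⟨ cong suc (+-comm δ m) ⟩
        suc (m + δ)                 ∎))
        where open ≤-Reasoning

      dense-progress : ∀ {c} → m < pairs c → AllDominated G c ⊎ ∃[ d ] (Step G c d × m < pairs d)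
      dense-progress {c} m<pairs with all-dominated-or-witness c
      ... | inj₁ all = inj₁ all
      ... | inj₂ (u , ¬dom) with any? (λ z → 2 ≤? c z)
      ...   | no ¬stack =
        ⊥-elim (<⇒≱ m<pairs (≤-trans (pairs≤coverage c (no-stack⇒bounded ¬stack)) (coverage≤m ¬dom)))
      ...   | yes (z , 2≤cz) with empty-common-neighbour ¬dom (≤-trans (s≤s z≤n) 2≤cz)
      ...     | w , zw , _ , cw≡0 =
        inj₂ (move c z w , pebble zw 2≤cz ,
              subst (m <_) (sym (pairs-move (adjacent⇒distinct G zw) 2≤cz cw≡0)) m<pairs)

      dense-dominable : ∀ c → 2 * m < size c → Dominable c
      dense-dominable c 2m<size =
        descend G (λ c → m < pairs c) (AllDominated G) dense-progress
                (*-cancelˡ-< 2 m (pairs c) (<-≤-trans 2m<size (size≤2*pairs c)))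

    -- Domination from n − 1 pebbles

    NextToDouble : Config n → Pred (Fin n) _
    NextToDouble c v = c v ≡ 0 × ∃[ s ] (Adj G v s × c s ≡ 2)

    nextToDouble? : ∀ c → Decidable (NextToDouble c)
    nextToDouble? c v = (c v ≟ℕ 0) ×-dec any? (λ s → adj? v s ×-dec (c s ≟ℕ 2))

    Critical : Config n → Pred (Fin n) _
    Critical c = ∁ (Dominated c) ∪ NextToDouble c

    critical? : ∀ c → Decidable (Critical c)
    critical? c = ∁? (dominated? c) ∪? nextToDouble? c

    critical⇒empty : ∀ {c v} → Critical c v → c v ≡ 0
    critical⇒empty {c} (inj₁ ¬dom)   = uncovered⇒empty {c = c} (¬dom ∘ inj₁)
    critical⇒empty     (inj₂ (e , _)) = e

    -- Firing a double towards an undominated vertex u through w makes u and w non-critical, and of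
    -- the other vertices only the emptied double can become critical, which needs a second double.
    Balanced : Config n → Set
    Balanced c = ∃ (∁ (Dominated c)) → 0 < doubles c × count (critical? c) ≤ suc (doubles c)

    module FiringDouble {c u z w} (¬dom : ¬ Dominated c u) (cz≡2 : c z ≡ 2)
                        (zw : Adj G z w) (wu : Adj G w u) (cw≡0 : c w ≡ 0) where

      c′ : Config n
      c′ = move c z w

      z≢w : z ≢ w
      z≢w = adjacent⇒distinct G zw

      c′z≡0 : c′ z ≡ 0
      c′z≡0 = trans (move-source c) (cong (_∸ 2) cz≡2)

      c′w≡1 : c′ w ≡ 1
      c′w≡1 = trans (move-target c z≢w) (cong suc cw≡0)

      double-before : ∀ {s} → c′ s ≡ 2 → c s ≡ 2
      double-before {s} c′s≡2 = by-cases (s ≟ z) (s ≟ w)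
        where
        by-cases : Dec (s ≡ z) → Dec (s ≡ w) → c s ≡ 2
        by-cases (yes s≡z) _ =
          ⊥-elim (0≢1+n (trans (sym c′z≡0) (subst (λ x → c′ x ≡ 2) s≡z c′s≡2)))
        by-cases (no _) (yes s≡w) =
          ⊥-elim (0≢1+n (suc-injective (trans (sym c′w≡1) (subst (λ x → c′ x ≡ 2) s≡w c′s≡2))))
        by-cases (no s≢z) (no s≢w) = trans (sym (move-other c s≢z s≢w)) c′s≡2

      covered-after : ∀ {s} → s ≢ z → Covered c s → Covered c′ s
      covered-after {s} s≢z cov with s ≟ w
      ... | yes s≡w = subst (Covered c′) (sym s≡w) (≤-reflexive (sym c′w≡1))
      ... | no s≢w  = subst (1 ≤_) (sym (move-other c s≢z s≢w)) cov

      doubles-after : doubles c ≤ suc (doubles c′)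
      doubles-after = begin
        doubles c                                  ≡⟨ count-remove (double? c) cz≡2 ⟩
        suc (count (double? c ∩? ∁? (z ≟_)))       ≤⟨ s≤s (count-mono _ (double? c′) still-double) ⟩
        suc (doubles c′)                           ∎
        where
        open ≤-Reasoning
        still-double : ∀ {v} → c v ≡ 2 × z ≢ v → c′ v ≡ 2
        still-double {v} (cv≡2 , z≢v) =
          trans (move-other c (z≢v ∘ sym) (λ { refl → 0≢1+n (trans (sym cw≡0) cv≡2) })) cv≡2

      c′-dominates-u : Dominated c′ u
      c′-dominates-u = inj₂ (w , symmetric G wu , ≤-reflexive (sym c′w≡1))

      u-not-critical : ¬ Critical c′ u
      u-not-critical (inj₁ ¬dom′)                 = ¬dom′ c′-dominates-u
      u-not-critical (inj₂ (_ , s , us , c′s≡2)) =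
        ¬dom (inj₂ (s , us , ≤-trans (s≤s z≤n) (≤-reflexive (sym (double-before c′s≡2)))))

      w-not-critical : ¬ Critical c′ w
      w-not-critical crit′ = 0≢1+n (trans (sym (critical⇒empty crit′)) c′w≡1)

      was-empty : ∀ {v} → Critical c′ v → z ≢ v → c v ≡ 0
      was-empty {v} crit′ z≢v = trans (sym (move-other c (z≢v ∘ sym) w≢v)) (critical⇒empty crit′)
        where
        w≢v : v ≢ w
        w≢v v≡w = w-not-critical (subst (Critical c′) v≡w crit′)

      critical-before : ∀ {v} → Critical c′ v → z ≢ v → Critical c v
      critical-before crit′@(inj₂ (_ , s , vs , c′s≡2)) z≢v =
        inj₂ (was-empty crit′ z≢v , s , vs , double-before c′s≡2)
      critical-before {v} crit′@(inj₁ ¬dom′) z≢v with dominated? c v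
      ... | no ¬domv       = inj₁ ¬domv
      ... | yes (inj₁ cov) = ⊥-elim (¬dom′ (inj₁ (covered-after (z≢v ∘ sym) cov)))
      ... | yes (inj₂ (s , vs , cov-s)) with s ≟ z
      ...   | no s≢z  = ⊥-elim (¬dom′ (inj₂ (s , vs , covered-after s≢z cov-s)))
      ...   | yes s≡z = inj₂ (was-empty crit′ z≢v , s , vs , trans (cong c s≡z) cz≡2)

      critical-after : count (critical? c′) + 2 ≤ count (critical? c) + 𝟙 (nextToDouble? c′ z)
      critical-after = begin
        count (critical? c′) + 2
          ≡⟨ cong (_+ 2) (count-split (critical? c′) z) ⟩
        𝟙 (critical? c′ z) + count (critical? c′ ∩? ∁? (z ≟_)) + 2
          ≤⟨ +-monoˡ-≤ 2 (+-mono-≤ (𝟙-mono z-critical (critical? c′ z) (nextToDouble? c′ z))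
                                    (count-mono (critical? c′ ∩? ∁? (z ≟_)) rest still-critical)) ⟩
        𝟙 (nextToDouble? c′ z) + count rest + 2
          ≡⟨ rearrange (𝟙 (nextToDouble? c′ z)) (count rest) ⟩
        suc (suc (count rest)) + 𝟙 (nextToDouble? c′ z)
          ≡⟨ cong (_+ 𝟙 (nextToDouble? c′ z)) (sym two-fewer) ⟩
        count (critical? c) + 𝟙 (nextToDouble? c′ z) ∎
        where
        open ≤-Reasoning
        rest : Decidable ((Critical c ∩ ∁ (u ≡_)) ∩ ∁ (w ≡_))
        rest = (critical? c ∩? ∁? (u ≟_)) ∩? ∁? (w ≟_)
        rearrange : ∀ a r → a + r + 2 ≡ suc (suc r) + a
        rearrange = solve-∀
        z-critical : Critical c′ z → NextToDouble c′ z
        z-critical (inj₁ ¬dom′) = ⊥-elim (¬dom′ (inj₂ (w , zw , ≤-reflexive (sym c′w≡1))))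
        z-critical (inj₂ next)  = next
        still-critical : ∀ {v} → Critical c′ v × z ≢ v → (Critical c v × u ≢ v) × w ≢ v
        still-critical (crit′ , z≢v) =
          (critical-before crit′ z≢v , λ u≡v → u-not-critical (subst (Critical c′) (sym u≡v) crit′)) ,
          λ w≡v → w-not-critical (subst (Critical c′) (sym w≡v) crit′)
        two-fewer : count (critical? c) ≡ suc (suc (count rest))
        two-fewer = trans (count-remove (critical? c) (inj₁ ¬dom))
                          (cong suc (count-remove (critical? c ∩? ∁? (u ≟_))
                                                  (inj₂ (cw≡0 , z , symmetric G zw , cz≡2) ,
                                                   λ u≡w → irrefl G (subst (Adj G w) u≡w wu))))

      balanced-after : Balanced c → Balanced c′
      balanced-after balanced (_ , ¬dom′) with balanced (u , ¬dom)
      ... | _ , critical≤ = by-cases (nextToDouble? c′ z) critical-after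
        where
        shrinks : ∀ k → count (critical? c′) + 2 ≤ count (critical? c) + k →
                  count (critical? c′) ≤ doubles c′ + k
        shrinks k le = +-cancelʳ-≤ 2 _ _ (begin
          count (critical? c′) + 2   ≤⟨ le ⟩
          count (critical? c) + k    ≤⟨ +-monoˡ-≤ k (≤-trans critical≤ (s≤s doubles-after)) ⟩
          suc (suc (doubles c′)) + k ≡⟨ rearrange (doubles c′) k ⟩
          doubles c′ + k + 2         ∎)
          where
          open ≤-Reasoning
          rearrange : ∀ d k → suc (suc d) + k ≡ d + k + 2
          rearrange = solve-∀
        by-cases : (next? : Dec (NextToDouble c′ z)) →
                   count (critical? c′) + 2 ≤ count (critical? c) + 𝟙 next? →
                   0 < doubles c′ × count (critical? c′) ≤ suc (doubles c′)
        by-cases (yes (_ , s , _ , c′s≡2)) le =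
          ∈⇒0<count (double? c′) {s} c′s≡2 , ≤-trans (shrinks 1 le) (≤-reflexive (+-comm _ 1))
        by-cases (no _) le =
          ≤-trans (∈⇒0<count (critical? c′) (inj₁ ¬dom′)) critical′≤ , m≤n⇒m≤1+n critical′≤
          where
          critical′≤ : count (critical? c′) ≤ doubles c′
          critical′≤ = ≤-trans (shrinks 0 le) (≤-reflexive (+-identityʳ _))

    double-progress : ∀ {c} → Balanced c → AllDominated G c ⊎ ∃[ d ] (Step G c d × Balanced d)
    double-progress {c} balanced with all-dominated-or-witness c
    ... | inj₁ all = inj₁ all
    ... | inj₂ (u , ¬dom) with 0<count⇒∃ (double? c) (proj₁ (balanced (u , ¬dom)))
    ...   | z , cz≡2 with empty-common-neighbour ¬dom (subst (1 ≤_) (sym cz≡2) (s≤s z≤n))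
    ...     | w , zw , wu , cw≡0 =
      inj₂ (move c z w , pebble zw (≤-reflexive (sym cz≡2)) ,
            FiringDouble.balanced-after ¬dom cz≡2 zw wu cw≡0 balanced)

    module Stacks (c₀ : Config n) (c₀-nonempty : 0 < size c₀) (n≤ : n ≤ suc (size c₀)) where

      NewlyDominated : Config n → Pred (Fin n) _
      NewlyDominated c v = ¬ Dominated c₀ v × Dominated c v × c v ≡ 0

      newlyDominated? : ∀ c → Decidable (NewlyDominated c)
      newlyDominated? c v = ∁? (dominated? c₀) v ×-dec dominated? c v ×-dec (c v ≟ℕ 0)

      -- A move from a stack of three or more spends one pebble and newly dominates an empty vertex,
      -- without undominating or emptying anything.
      record StackInvariant (c : Config n) : Set where
        field
          keeps-covered : ∀ {v} → Covered c₀ v → Covered c v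
          stacks-on-c₀  : ∀ {v} → 2 ≤ c v → Covered c₀ v
          budget        : size c₀ ≤ size c + count (newlyDominated? c)

      open StackInvariant

      still-dominated : ∀ {c v} → StackInvariant c → Dominated c₀ v → Dominated c v
      still-dominated inv = dominated-mono (keeps-covered inv)

      module FiringStack {c u z w} (inv : StackInvariant c) (¬dom : ¬ Dominated c u) (3≤cz : 3 ≤ c z)
                         (zw : Adj G z w) (wu : Adj G w u) (cw≡0 : c w ≡ 0) where

        c′ : Config n
        c′ = move c z w

        z≢w : z ≢ w
        z≢w = adjacent⇒distinct G zw

        c′w≡1 : c′ w ≡ 1
        c′w≡1 = trans (move-target c z≢w) (cong suc cw≡0)

        step : Step G c c′
        step = pebble zw (≤-trans (n≤1+n 2) 3≤cz)

        covered-after : ∀ {v} → Covered c v → Covered c′ v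
        covered-after {v} cov = by-cases (v ≟ z) (v ≟ w)
          where
          by-cases : Dec (v ≡ z) → Dec (v ≡ w) → Covered c′ v
          by-cases (yes v≡z) _ =
            subst (Covered c′) (sym v≡z) (subst (1 ≤_) (sym (move-source c)) (∸-monoˡ-≤ 2 3≤cz))
          by-cases (no _) (yes v≡w) = subst (Covered c′) (sym v≡w) (≤-reflexive (sym c′w≡1))
          by-cases (no v≢z) (no v≢w) = subst (1 ≤_) (sym (move-other c v≢z v≢w)) cov

        w-dominated₀ : Dominated c₀ w
        w-dominated₀ = inj₂ (z , symmetric G zw , stacks-on-c₀ inv (≤-trans (n≤1+n 2) 3≤cz))

        empty≢z : ∀ {v} → c v ≡ 0 → v ≢ z
        empty≢z cv≡0 v≡z = m<n⇒n≢0 (≤-trans (s≤s z≤n) 3≤cz) (trans (cong c (sym v≡z)) cv≡0)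

        u-newly-dominated : NewlyDominated c′ u
        u-newly-dominated =
          ¬dom ∘ still-dominated inv ,
          inj₂ (w , symmetric G wu , ≤-reflexive (sym c′w≡1)) ,
          trans (move-other c (empty≢z cu≡0) (λ u≡w → irrefl G (subst (Adj G w) u≡w wu))) cu≡0
          where
          cu≡0 : c u ≡ 0
          cu≡0 = uncovered⇒empty {c = c} (¬dom ∘ inj₁)

        still-newly-dominated : ∀ {v} → NewlyDominated c v → NewlyDominated c′ v × u ≢ v
        still-newly-dominated {v} (¬dom₀ , dom , cv≡0) =
          (¬dom₀ , dominated-mono covered-after dom ,
           trans (move-other c (empty≢z cv≡0) (λ v≡w → ¬dom₀ (subst (Dominated c₀) (sym v≡w) w-dominated₀)))
                 cv≡0) ,
          λ u≡v → ¬dom (subst (Dominated c) (sym u≡v) dom)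

        newly-dominated-grows : suc (count (newlyDominated? c)) ≤ count (newlyDominated? c′)
        newly-dominated-grows = begin
          suc (count (newlyDominated? c))
            ≤⟨ s≤s (count-mono (newlyDominated? c) (newlyDominated? c′ ∩? ∁? (u ≟_)) still-newly-dominated) ⟩
          suc (count (newlyDominated? c′ ∩? ∁? (u ≟_)))
            ≡⟨ sym (count-remove (newlyDominated? c′) u-newly-dominated) ⟩
          count (newlyDominated? c′) ∎
          where open ≤-Reasoning

        invariant-after : StackInvariant c′
        keeps-covered invariant-after = covered-after ∘ keeps-covered inv
        stacks-on-c₀  invariant-after {v} 2≤c′v = by-cases (v ≟ z) (v ≟ w)
          where
          by-cases : Dec (v ≡ z) → Dec (v ≡ w) → Covered c₀ v
          by-cases (yes v≡z) _ = subst (Covered c₀) (sym v≡z) (stacks-on-c₀ inv (≤-trans (n≤1+n 2) 3≤cz))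
          by-cases (no _) (yes v≡w) =
            ⊥-elim (<⇒≱ (s≤s (s≤s z≤n)) (subst (2 ≤_) (trans (cong c′ v≡w) c′w≡1) 2≤c′v))
          by-cases (no v≢z) (no v≢w) = stacks-on-c₀ inv (subst (2 ≤_) (move-other c v≢z v≢w) 2≤c′v)
        budget        invariant-after = begin
          size c₀                              ≤⟨ budget inv ⟩
          size c + F                           ≡⟨ cong (_+ F) (sym (step-size G step)) ⟩
          suc (size c′) + F                    ≡⟨ sym (+-suc (size c′) F) ⟩
          size c′ + suc F                      ≤⟨ +-monoʳ-≤ (size c′) newly-dominated-grows ⟩
          size c′ + count (newlyDominated? c′) ∎
          where
          open ≤-Reasoning
          F : ℕ
          F = count (newlyDominated? c)

      Stale : Config n → Pred (Fin n) _
      Stale c v = Dominated c₀ v × c v ≡ 0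

      stale? : ∀ c → Decidable (Stale c)
      stale? c v = dominated? c₀ v ×-dec (c v ≟ℕ 0)

      -- Covered, stale, newly dominated and undominated vertices are disjoint, so the budget bounds the
      -- stale and undominated vertices, which include every critical one, by one more than the doubles.
      module StackFree {c u} (inv : StackInvariant c) (all≤2 : ∀ v → c v ≤ 2) (¬dom : ¬ Dominated c u) where

        new? : Decidable (NewlyDominated c)
        new? = newlyDominated? c
        und? : Decidable (∁ (Dominated c))
        und? = ∁? (dominated? c)
        A B C D p : ℕ
        A = coverage c
        B = count (stale? c)
        C = count new?
        D = count und?
        p = doubles c

        stale∩undominated : ∀ {v} → Stale c v → ¬ ¬ Dominated c v
        stale∩undominated (dom₀ , _) ¬dom′ = ¬dom′ (still-dominated inv dom₀)

        partition : A + (B + (C + D)) ≤ n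
        partition = begin
          A + (B + (C + D))                  ≡⟨ cong (λ k → A + (B + k)) (sym (count-∪ new? und? new∩und)) ⟩
          A + (B + count (new? ∪? und?))     ≡⟨ cong (A +_) (sym (count-∪ (stale? c) (new? ∪? und?) stale∩rest)) ⟩
          A + count (stale? c ∪? new? ∪? und?) ≡⟨ sym (count-∪ (covered? c) (stale? c ∪? new? ∪? und?) covered∩rest) ⟩
          count every?                       ≤⟨ count≤n every? ⟩
          n                                  ∎
          where
          open ≤-Reasoning
          every? : Decidable (Covered c ∪ Stale c ∪ NewlyDominated c ∪ ∁ (Dominated c))
          every? = covered? c ∪? stale? c ∪? new? ∪? und?
          new∩und : ∀ {v} → NewlyDominated c v → ¬ ¬ Dominated c v
          new∩und (_ , dom , _) ¬dom′ = ¬dom′ dom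
          stale∩rest : ∀ {v} → Stale c v → ¬ (NewlyDominated c v ⊎ ¬ Dominated c v)
          stale∩rest stale = [ (λ (¬dom₀ , _) → ¬dom₀ (proj₁ stale)) , stale∩undominated stale ]
          covered∩rest : ∀ {v} → Covered c v → ¬ (Stale c v ⊎ NewlyDominated c v ⊎ ¬ Dominated c v)
          covered∩rest cov =
            [ (λ (_ , e) → m<n⇒n≢0 cov e) , [ (λ (_ , _ , e) → m<n⇒n≢0 cov e) , (λ ¬dom′ → ¬dom′ (inj₁ cov)) ] ]

        size-split : size c ≡ A + p
        size-split = trans (size≡sum c) (trans (sum-cong-≗ (λ v → pointwise (c v) (all≤2 v)))
                                                (∑-distrib-+ (𝟙 ∘ covered? c) (𝟙 ∘ double? c)))
          where
          pointwise : ∀ k → k ≤ 2 → k ≡ 𝟙 (1 ≤? k) + 𝟙 (k ≟ℕ 2)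
          pointwise zero          _                 = refl
          pointwise (suc zero)    _                 = refl
          pointwise (suc (suc zero)) _              = refl
          pointwise (suc (suc (suc _))) (s≤s (s≤s ()))

        B+D≤ : B + D ≤ suc p
        B+D≤ = +-cancelˡ-≤ (A + C) _ _ (begin
          A + C + (B + D)       ≡⟨ rearrangeˡ A B C D ⟩
          A + (B + (C + D))     ≤⟨ partition ⟩
          n                     ≤⟨ n≤ ⟩
          suc (size c₀)         ≤⟨ s≤s (budget inv) ⟩
          suc (size c + C)      ≡⟨ cong (λ s → suc (s + C)) size-split ⟩
          suc (A + p + C)       ≡⟨ rearrangeʳ A p C ⟩
          A + C + suc p         ∎)
          where
          open ≤-Reasoning
          rearrangeˡ : ∀ a b c d → a + c + (b + d) ≡ a + (b + (c + d))
          rearrangeˡ = solve-∀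
          rearrangeʳ : ∀ a p c → suc (a + p + c) ≡ a + c + suc p
          rearrangeʳ = solve-∀

        critical≤ : count (critical? c) ≤ B + D
        critical≤ = begin
          count (critical? c)          ≤⟨ count-mono (critical? c) (stale? c ∪? und?) critical⇒stale ⟩
          count (stale? c ∪? und?)     ≡⟨ count-∪ (stale? c) und? stale∩undominated ⟩
          B + D                        ∎
          where
          open ≤-Reasoning
          critical⇒stale : Critical c ⊆ Stale c ∪ ∁ (Dominated c)
          critical⇒stale (inj₁ ¬dom′)                = inj₂ ¬dom′
          critical⇒stale (inj₂ (cv≡0 , s , vs , cs≡2)) =
            inj₁ (inj₂ (s , vs , stacks-on-c₀ inv (≤-reflexive (sym cs≡2))) , cv≡0)

        0<B : 0 < B
        0<B with sum-pos c₀ (<-≤-trans c₀-nonempty (≤-reflexive (size≡sum c₀)))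
        ... | s , cov₀ with empty-common-neighbour ¬dom (keeps-covered inv cov₀)
        ...   | w , sw , _ , cw≡0 = ∈⇒0<count (stale? c) (inj₂ (s , symmetric G sw , cov₀) , cw≡0)

        0<doubles : 0 < p
        0<doubles = ≤-pred (begin
          2        ≤⟨ +-mono-≤ 0<B (∈⇒0<count und? ¬dom) ⟩
          B + D    ≤⟨ B+D≤ ⟩
          suc p    ∎)
          where open ≤-Reasoning

      stack-free-balanced : ∀ {c} → StackInvariant c → (∀ v → c v ≤ 2) → Balanced c
      stack-free-balanced inv all≤2 (_ , ¬dom) = 0<doubles , ≤-trans critical≤ B+D≤
        where open StackFree inv all≤2 ¬dom

      stack-progress : ∀ {c} → StackInvariant c → Balanced c ⊎ ∃[ d ] (Step G c d × StackInvariant d)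
      stack-progress {c} inv with any? (λ z → 3 ≤? c z)
      ... | no ¬stack = inj₁ (stack-free-balanced inv (no-stack⇒bounded ¬stack))
      ... | yes (z , 3≤cz) with all-dominated-or-witness c
      ...   | inj₁ all = inj₁ (λ (u , ¬dom) → ⊥-elim (¬dom (all u)))
      ...   | inj₂ (u , ¬dom) with empty-common-neighbour ¬dom (≤-trans (s≤s z≤n) 3≤cz)
      ...     | w , zw , wu , cw≡0 =
        inj₂ (move c z w , FiringStack.step inv ¬dom 3≤cz zw wu cw≡0 ,
              FiringStack.invariant-after inv ¬dom 3≤cz zw wu cw≡0)

      initial : StackInvariant c₀
      keeps-covered initial = λ cov → cov
      stacks-on-c₀  initial = ≤-trans (s≤s z≤n)
      budget        initial = m≤m+n (size c₀) _

    sparse-dominable : ∀ c₀ → 0 < size c₀ → n ≤ suc (size c₀) → Dominable c₀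
    sparse-dominable c₀ c₀-nonempty n≤ =
      let c , c₀↝c , balanced = descend G StackInvariant Balanced stack-progress initial
          d , c↝d , all       = descend G Balanced (AllDominated G) double-progress balanced
      in d , c₀↝c ◅◅ c↝d , all
      where open Stacks c₀ c₀-nonempty n≤

    dom-solvable-within-third : ∀ {L} x → (∀ v → degree x ≤ degree v) → 2 ≤ n →
                                4 * n ≤ L + 2 * degree x + 3 → ∃[ K ] (DomSolvable G K × 3 * K ≤ L)
    dom-solvable-within-third x minimal 2≤n lower with n ≤? 2 * degree x
    ... | yes dense =
      suc (2 * (n ∸ suc (degree x))) ,
      (λ c size≡ → dense-dominable {m = n ∸ suc (degree x)} minimal (m≤n+m∸n n (suc (degree x)))
                                   c (≤-reflexive (sym size≡))) ,
      dense-arithmetic (∉⇒count<n (adj? x) (irrefl G)) lower dense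
    ... | no sparse =
      n ∸ 1 ,
      (λ c size≡ → sparse-dominable c (subst (0 <_) (sym size≡) (∸-monoˡ-≤ 1 2≤n))
                                      (subst (λ s → n ≤ suc s) (sym size≡) (m≤n+m∸n n 1))) ,
      sparse-arithmetic {d = degree x} lower sparse

    ratio-bound : ∀ {λG ψG} → Fin n → 2 ≤ n →
                  IsCoverPebblingNumber G λG → IsDomCoverPebblingNumber G ψG → 3 * ψG ≤ λG
    ratio-bound x₀ 2≤n (λ-solvable , _) (_ , ψ-minimal) =
      let K , K-solvable , 3K≤λ = dom-solvable-within-third x minimal 2≤n (cover-lower-bound x λ-solvable)
      in ≤-trans (*-monoʳ-≤ 3 (≮⇒≥ (λ K<ψ → ψ-minimal K K<ψ K-solvable))) 3K≤λ
      where
      x : Fin n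
      x = argmin degree x₀ (allFin n)
      minimal : ∀ v → degree x ≤ degree v
      minimal v = All.lookup (f[argmin]≤f[xs] x₀ (allFin n)) (∈-allFin v)

¬¬-adjacency-decidable : (G : Graph n) → ¬ ¬ (∀ u v → Dec (Adj G u v))
¬¬-adjacency-decidable G = sequence rawApplicative (λ _ → sequence rawApplicative (λ _ → ¬¬-excluded-middle))
  where open RawMonad ¬¬-Monad using (rawApplicative)

distinct⇒2≤n : {u v : Fin n} → u ≢ v → 2 ≤ n
distinct⇒2≤n {suc zero}    {fzero} {fzero} u≢v = ⊥-elim (u≢v refl)
distinct⇒2≤n {suc (suc n)} _                   = s≤s (s≤s z≤n)

mainTheorem2 : ∀ (n : ℕ) (G : Graph n) → DiameterTwo G →
    ∀ (λG ψG : ℕ) → IsCoverPebblingNumber G λG → IsDomCoverPebblingNumber G ψG →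
    3 * ψG ≤ λG
mainTheorem2 n G (within-two , u , _ , u≢v , _) λG ψG cover domination =
  decidable-stable (3 * ψG ≤? λG) λ ratio-fails →
    ¬¬-adjacency-decidable G λ adj? →
      ratio-fails (ratio-bound G adj? within-two u (distinct⇒2≤n u≢v) cover domination)
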